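{- Let $G=(V,E)$ be a graph and $e=\{u,v\}\in E$ an edge with $N[u]=N[v]$. Then $$\mathrm{ID}(G,x)=\mathrm{ID}(G-e,x)+(2x-x^2)\,\mathrm{ID}(G-N[u],x).$$
   Context: All graphs are finite, simple and undirected. $N[w]$ is the closed neighborhood of $w$ (its neighbors together with $w$). $G-e$ removes the edge $e$. $G-N[u]$ deletes all vertices of $N[u]$; if no vertices remain, $\mathrm{ID}$ of the resulting graph is $1$. A set $W\subseteq V$ is an independent dominating set of $G=(V,E)$ if every vertex of $V\setminus W$ is adjacent to at least one vertex of $W$ and no two vertices of $W$ are adjacent. The independent domination polynomial is $\mathrm{ID}(G,x)=\sum_{W}x^{|W|}$, the sum over all independent dominating sets $W$ of $G$. -}

module Defs where

open import Data.Bool using (Bool; true; false; _∧_; _∨_; not; if_then_else_)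
open import Data.Nat using (ℕ; zero; suc)
open import Data.Integer using (ℤ; +_; _-_) renaming (_+_ to _+ℤ_; _*_ to _*ℤ_)
open import Data.Fin using (Fin; _≟_)
open import Data.Fin.Subset using (Subset; ∣_∣)
open import Data.Vec using (Vec; []; _∷_; lookup; tabulate)
open import Data.List using (List; []; _∷_; map; allFin; _++_; replicate; foldr)
open import Data.Bool.ListAction using (all; any)
open import Relation.Nullary.Decidable using (⌊_⌋; yes; no)
open import Data.Empty using (⊥-elim)
open import Relation.Binary.PropositionalEquality using (_≡_; refl; sym; trans)
open import Data.Bool.Properties using (∧-comm; ∨-comm)

record Graph (n : ℕ) : Set where
  field
    adj     : Fin n → Fin n → Bool
    adj-sym : ∀ i j → adj i j ≡ adj j i
    adj-irr : ∀ i → adj i i ≡ false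
open Graph public

_==_ : ∀ {n} → Fin n → Fin n → Bool
i == j = ⌊ i ≟ j ⌋

==-sym : ∀ {n} (i j : Fin n) → (i == j) ≡ (j == i)
==-sym i j with i ≟ j | j ≟ i
... | yes _ | yes _ = refl
... | no _  | no _  = refl
... | yes p | no ¬q = ⊥-elim (¬q (sym p))
... | no ¬p | yes q = ⊥-elim (¬p (sym q))

isEdgeUV : ∀ {n} → Fin n → Fin n → Fin n → Fin n → Bool
isEdgeUV u v i j = ((i == u) ∧ (j == v)) ∨ ((i == v) ∧ (j == u))

private
  isEdgeUV-sym : ∀ {n} (u v i j : Fin n) → isEdgeUV u v i j ≡ isEdgeUV u v j i
  isEdgeUV-sym u v i j
    rewrite ==-sym i u | ==-sym j v | ==-sym i v | ==-sym j u
          | ∧-comm (u == i) (v == j) | ∧-comm (v == i) (u == j)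
          = ∨-comm (v == j ∧ u == i) (u == j ∧ v == i)


removeEdge : ∀ {n} → Graph n → Fin n → Fin n → Graph n
removeEdge G u v = record
  { adj     = λ i j → adj G i j ∧ not (isEdgeUV u v i j)
  ; adj-sym = λ i j → Relation.Binary.PropositionalEquality.cong₂ _∧_
                        (adj-sym G i j)
                        (Relation.Binary.PropositionalEquality.cong not (isEdgeUV-sym u v i j))
  ; adj-irr = λ i → Relation.Binary.PropositionalEquality.cong (_∧ _) (adj-irr G i)
  }

closedNbhd : ∀ {n} → Graph n → Fin n → Fin n → Bool
closedNbhd G u w = (w == u) ∨ adj G u w

-- Vertex subsets (Data.Fin.Subset: Vec Bool n) and induced subgraphs.
-- An induced subgraph G[S] is represented by the pair (G , S).

_∈ˢ_ : ∀ {n} → Fin n → Subset n → Bool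
i ∈ˢ S = lookup S i

full : ∀ n → Subset n
full n = tabulate (λ _ → true)

-- V(G) \ N[u], the vertex set of G - N[u] (as induced subgraph)
minusClosedNbhd : ∀ {n} → Graph n → Fin n → Subset n
minusClosedNbhd G u = tabulate (λ w → not (closedNbhd G u w))

allSubsets : ∀ n → List (Subset n)
allSubsets zero    = [] ∷ []
allSubsets (suc n) = map (true ∷_) (allSubsets n) ++ map (false ∷_) (allSubsets n)

vs : ∀ n → List (Fin n)
vs n = allFin n

isIDS : ∀ {n} → Graph n → Subset n → Subset n → Bool
isIDS {n} G S W =
  all (λ i → not (i ∈ˢ W) ∨ (i ∈ˢ S)) (vs n)
  ∧ all (λ i → all (λ j → not ((i ∈ˢ W) ∧ (j ∈ˢ W)) ∨ not (adj G i j)) (vs n)) (vs n)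
  ∧ all (λ v → not ((v ∈ˢ S) ∧ not (v ∈ˢ W))
               ∨ any (λ w → (w ∈ˢ W) ∧ adj G v w) (vs n)) (vs n)

-- Polynomials over ℤ as coefficient lists (constant term first)

Poly : Set
Poly = List ℤ

coeff : Poly → ℕ → ℤ
coeff []       _       = + 0
coeff (a ∷ p) zero    = a
coeff (a ∷ p) (suc k) = coeff p k

_+ᴾ_ : Poly → Poly → Poly
[]      +ᴾ q       = q
(a ∷ p) +ᴾ []      = a ∷ p
(a ∷ p) +ᴾ (b ∷ q) = (a +ℤ b) ∷ (p +ᴾ q)

scale : ℤ → Poly → Poly
scale c = map (c *ℤ_)

_*ᴾ_ : Poly → Poly → Poly
[]      *ᴾ q = []
(a ∷ p) *ᴾ q = scale a q +ᴾ (+ 0 ∷ (p *ᴾ q))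

monomial : ℕ → Poly
monomial k = replicate k (+ 0) ++ (+ 1 ∷ [])

twoX-minus-X² : Poly
twoX-minus-X² = + 0 ∷ + 2 ∷ (+ 0 - + 1) ∷ []

IDpoly : ∀ {n} → Graph n → Subset n → Poly
IDpoly {n} G S =
  foldr (λ W acc → (if isIDS G S W then monomial ∣ W ∣ else []) +ᴾ acc) [] (allSubsets n)

ID : ∀ {n} → Graph n → Poly
ID {n} G = IDpoly G (full n)

_≈ᴾ_ : Poly → Poly → Set
p ≈ᴾ q = ∀ k → coeff p k ≡ coeff q k

module Submission where

-- We compare the k-th coefficients, each a sum over all vertex subsets W.  Grouping the
-- subsets in fours, W, W ∪ {u}, W ∪ {v}, W ∪ {u , v} with u, v ∉ W (ΣSubsets-pair), it
-- suffices to compare the contributions of each group.  Put m = |W|,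
-- a = [W is an IDS of G − e] and b = [W is an IDS of G − N[u]].  Then
--   in ID(G):      W gives a x^m (IDS-removeEdge), W ∪ {u} and W ∪ {v} each give b x^(m+1)
--                  (IDS-insert, N[u] = N[v]), and W ∪ {u , v} gives nothing (uv ∈ E);
--   in ID(G − e):  W gives a x^m, W ∪ {u} and W ∪ {v} give nothing (¬IDS-shadowed: the other
--                  end stays undominated), and W ∪ {u , v} gives b x^(m+2) (IDS-G-e-⁺uv);
--   in ID(G − N[u]): only W can contribute, giving b x^m, since u, v ∉ V ∖ N[u].
-- Both totals equal a x^m + 2b x^(m+1) (quad-agree).

open import Defs
open import Data.Bool using (Bool; true; false; T; _∧_; _∨_; not; if_then_else_)
open import Data.Bool.Properties using (T-≡; T-not-≡; T-∧; T?; ∧-zeroʳ; ∧-identityʳ)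
open import Data.Bool.ListAction using (all; any)
open import Data.Nat using (ℕ; zero; suc; _≡ᵇ_)
open import Data.Integer using (ℤ; +_; _+_; _*_; _-_)
open import Data.Integer.Properties using (*-zeroʳ; *-identityˡ; +-identityˡ; +-identityʳ; +-comm)
open import Data.Integer.Tactic.RingSolver using (solve-∀)
open import Data.Fin using (Fin; zero; suc; _≟_)
open import Data.Fin.Subset using (Subset; ∣_∣)
open import Data.Vec using ([]; _∷_; lookup; _[_]≔_)
open import Data.Vec.Properties using (lookup∘update; lookup∘update′; lookup∘tabulate; tabulate-cong)
open import Data.List using (List; []; _∷_; _++_; map; foldr; allFin)
open import Data.List.Relation.Unary.All as All using ()
open import Data.List.Relation.Unary.All.Properties using (all⁺; all⁻)
open import Data.List.Relation.Unary.Any as Any using ()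
open import Data.List.Relation.Unary.Any.Properties using (any⁺; any⁻)
open import Data.List.Membership.Propositional using (lose)
open import Data.List.Membership.Propositional.Properties using (∈-allFin)
open import Data.Unit using (tt)
open import Data.Empty using (⊥-elim)
open import Data.Product using (_×_; _,_; ∃-syntax; proj₁; proj₂)
open import Data.Sum using (_⊎_; inj₁; inj₂)
open import Function.Base using (_∘_)
open import Function.Bundles using (_⇔_; mk⇔)
open Function.Bundles.Equivalence using (to; from)
open import Relation.Nullary using (¬_; yes; no)
open import Relation.Nullary.Decidable using (toWitness; fromWitness; fromWitnessFalse)
open import Relation.Binary.PropositionalEquality
  using (_≡_; _≢_; ≢-sym; refl; sym; trans; cong; cong₂; subst; module ≡-Reasoning)
open ≡-Reasoning

sumOver : {A : Set} → List A → (A → ℤ) → ℤ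
sumOver []       f = + 0
sumOver (x ∷ xs) f = f x + sumOver xs f

sumOver-cong : {A : Set} (xs : List A) {f g : A → ℤ} → (∀ x → f x ≡ g x) → sumOver xs f ≡ sumOver xs g
sumOver-cong []       f≗g = refl
sumOver-cong (x ∷ xs) f≗g = cong₂ _+_ (f≗g x) (sumOver-cong xs f≗g)

sumOver-+ : {A : Set} (xs : List A) (f g : A → ℤ) →
            sumOver xs (λ x → f x + g x) ≡ sumOver xs f + sumOver xs g
sumOver-+ []       f g = refl
sumOver-+ (x ∷ xs) f g = begin
  (f x + g x) + sumOver xs (λ y → f y + g y) ≡⟨ cong (λ s → (f x + g x) + s) (sumOver-+ xs f g) ⟩
  (f x + g x) + (sumOver xs f + sumOver xs g) ≡⟨ interchange (f x) (g x) _ _ ⟩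
  (f x + sumOver xs f) + (g x + sumOver xs g) ∎
  where
  interchange : ∀ a b c d → (a + b) + (c + d) ≡ (a + c) + (b + d)
  interchange = solve-∀

sumOver-++ : {A : Set} (xs ys : List A) (f : A → ℤ) → sumOver (xs ++ ys) f ≡ sumOver xs f + sumOver ys f
sumOver-++ []       ys f = sym (+-identityˡ _)
sumOver-++ (x ∷ xs) ys f = trans (cong (λ s → f x + s) (sumOver-++ xs ys f)) (assoc (f x) _ _)
  where
  assoc : ∀ a b c → a + (b + c) ≡ (a + b) + c
  assoc = solve-∀

sumOver-map : {A B : Set} (xs : List A) (g : A → B) (f : B → ℤ) → sumOver (map g xs) f ≡ sumOver xs (λ x → f (g x))
sumOver-map []       g f = refl
sumOver-map (x ∷ xs) g f = cong (λ s → f (g x) + s) (sumOver-map xs g f)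

sumOver-zero : {A : Set} (xs : List A) → sumOver xs (λ _ → + 0) ≡ + 0
sumOver-zero []       = refl
sumOver-zero (x ∷ xs) = trans (+-identityˡ _) (sumOver-zero xs)

ι : Bool → ℤ
ι true  = + 1
ι false = + 0

ΣSubsets : ∀ n → (Subset n → ℤ) → ℤ
ΣSubsets n h = sumOver (allSubsets n) h

ΣSubsets-suc : ∀ n (h : Subset (suc n) → ℤ) →
               ΣSubsets (suc n) h ≡ ΣSubsets n (λ W → h (true ∷ W)) + ΣSubsets n (λ W → h (false ∷ W))
ΣSubsets-suc n h = trans (sumOver-++ (map (true ∷_) (allSubsets n)) _ h)
                         (cong₂ _+_ (sumOver-map (allSubsets n) (true ∷_) h) (sumOver-map (allSubsets n) (false ∷_) h))

infixl 8 _⁺_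
_⁺_ : ∀ {n} → Subset n → Fin n → Subset n
W ⁺ z = W [ z ]≔ true

-- Pairing every subset not containing z with its extension by z.
ΣSubsets-split : ∀ n (z : Fin n) (h : Subset n → ℤ) →
                 ΣSubsets n h ≡ ΣSubsets n (λ W → ι (not (lookup W z)) * (h W + h (W ⁺ z)))
ΣSubsets-split (suc n) zero h = begin
  ΣSubsets (suc n) h                                     ≡⟨ ΣSubsets-suc n h ⟩
  withZ + withoutZ                                       ≡⟨ +-comm withZ withoutZ ⟩
  withoutZ + withZ                                       ≡⟨ sym (sumOver-+ (allSubsets n) _ _) ⟩
  ΣSubsets n (λ W → h (false ∷ W) + h (true ∷ W))        ≡⟨ sumOver-cong (allSubsets n) (λ W → sym (*-identityˡ _)) ⟩
  paired                                                 ≡⟨ sym (+-identityˡ _) ⟩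
  + 0 + paired                                           ≡⟨ cong (_+ paired) (sym (sumOver-zero (allSubsets n))) ⟩
  ΣSubsets n (λ _ → + 0) + paired                        ≡⟨ sym (ΣSubsets-suc n _) ⟩
  ΣSubsets (suc n) (λ W → ι (not (lookup W zero)) * (h W + h (W ⁺ zero))) ∎
  where
  withZ withoutZ paired : ℤ
  withZ    = ΣSubsets n (λ W → h (true ∷ W))
  withoutZ = ΣSubsets n (λ W → h (false ∷ W))
  paired   = ΣSubsets n (λ W → + 1 * (h (false ∷ W) + h (true ∷ W)))
ΣSubsets-split (suc n) (suc z) h = begin
  ΣSubsets (suc n) h ≡⟨ ΣSubsets-suc n h ⟩
  ΣSubsets n (λ W → h (true ∷ W)) + ΣSubsets n (λ W → h (false ∷ W))
    ≡⟨ cong₂ _+_ (ΣSubsets-split n z _) (ΣSubsets-split n z _) ⟩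
  _ ≡⟨ sym (ΣSubsets-suc n _) ⟩
  ΣSubsets (suc n) (λ W → ι (not (lookup W (suc z))) * (h W + h (W ⁺ suc z))) ∎

avoids : ∀ {n} → Fin n → Fin n → Subset n → Bool
avoids u v W = not (lookup W u) ∧ not (lookup W v)

quad : ∀ {n} → Fin n → Fin n → (Subset n → ℤ) → Subset n → ℤ
quad u v h W = h W + h (W ⁺ u) + h (W ⁺ v) + h (W ⁺ v ⁺ u)

ΣSubsets-pair : ∀ {n} {u v : Fin n} → u ≢ v → (h : Subset n → ℤ) →
                ΣSubsets n h ≡ ΣSubsets n (λ W → ι (avoids u v W) * quad u v h W)
ΣSubsets-pair {n} {u} {v} u≢v h = begin
  ΣSubsets n h                                                  ≡⟨ ΣSubsets-split n u h ⟩
  ΣSubsets n withU                                              ≡⟨ ΣSubsets-split n v withU ⟩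
  ΣSubsets n (λ W → ι (not (lookup W v)) * (withU W + withU (W ⁺ v))) ≡⟨ sumOver-cong (allSubsets n) regroup ⟩
  ΣSubsets n (λ W → ι (avoids u v W) * quad u v h W)            ∎
  where
  withU : Subset n → ℤ
  withU W = ι (not (lookup W u)) * (h W + h (W ⁺ u))

  indicators : ∀ a b x y z w → ι (not b) * (ι (not a) * (x + y) + ι (not a) * (z + w))
                             ≡ ι (not a ∧ not b) * (x + y + z + w)
  indicators true  true  x y z w = refl
  indicators true  false x y z w = refl
  indicators false true  x y z w = refl
  indicators false false x y z w = unit x y z w
    where
    unit : ∀ x y z w → + 1 * (+ 1 * (x + y) + + 1 * (z + w)) ≡ + 1 * (x + y + z + w)
    unit = solve-∀

  -- inserting v does not change membership of u
  regroup : ∀ W → ι (not (lookup W v)) * (withU W + withU (W ⁺ v)) ≡ ι (avoids u v W) * quad u v h W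
  regroup W rewrite lookup∘update′ u≢v W true =
    indicators (lookup W u) (lookup W v) (h W) (h (W ⁺ u)) (h (W ⁺ v)) (h (W ⁺ v ⁺ u))

-- the k-th coefficient of x^m
xPow : ℕ → ℕ → ℤ
xPow m k = ι (m ≡ᵇ k)

coeff-+ᴾ : ∀ p q k → coeff (p +ᴾ q) k ≡ coeff p k + coeff q k
coeff-+ᴾ []      q       k       = sym (+-identityˡ _)
coeff-+ᴾ (a ∷ p) []      k       = sym (+-identityʳ _)
coeff-+ᴾ (a ∷ p) (b ∷ q) zero    = refl
coeff-+ᴾ (a ∷ p) (b ∷ q) (suc k) = coeff-+ᴾ p q k

coeff-scale : ∀ c p k → coeff (scale c p) k ≡ c * coeff p k
coeff-scale c []      k       = sym (*-zeroʳ c)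
coeff-scale c (a ∷ p) zero    = refl
coeff-scale c (a ∷ p) (suc k) = coeff-scale c p k

coeff-monomial : ∀ m k → coeff (monomial m) k ≡ xPow m k
coeff-monomial zero    zero    = refl
coeff-monomial zero    (suc k) = refl
coeff-monomial (suc m) zero    = refl
coeff-monomial (suc m) (suc k) = coeff-monomial m k

coeff-IDpoly : ∀ {n} (G : Graph n) (S : Subset n) k →
               coeff (IDpoly G S) k ≡ ΣSubsets n (λ W → ι (isIDS G S W) * xPow ∣ W ∣ k)
coeff-IDpoly {n} G S k = coeff-sum (allSubsets n)
  where
  term : Subset n → Poly
  term W = if isIDS G S W then monomial ∣ W ∣ else []

  coeff-term : ∀ W → coeff (term W) k ≡ ι (isIDS G S W) * xPow ∣ W ∣ k
  coeff-term W with isIDS G S W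
  ... | true  = trans (coeff-monomial ∣ W ∣ k) (sym (*-identityˡ _))
  ... | false = refl

  coeff-sum : ∀ Ws → coeff (foldr (λ W acc → term W +ᴾ acc) [] Ws) k
                   ≡ sumOver Ws (λ W → ι (isIDS G S W) * xPow ∣ W ∣ k)
  coeff-sum []       = refl
  coeff-sum (W ∷ Ws) = trans (coeff-+ᴾ (term W) _ k) (cong₂ _+_ (coeff-term W) (coeff-sum Ws))

-- coefficients of x · p, in terms of those of p
shift : (ℕ → ℤ) → ℕ → ℤ
shift c zero    = + 0
shift c (suc k) = c k

shift-zero : ∀ k → shift (coeff []) k ≡ + 0
shift-zero zero    = refl
shift-zero (suc k) = refl

shift-xPow : ∀ m k → shift (xPow m) k ≡ xPow (suc m) k
shift-xPow m zero    = refl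
shift-xPow m (suc k) = refl

times2x-x² : (ℕ → ℤ) → ℕ → ℤ
times2x-x² c k = + 2 * shift c k - shift (shift c) k

coeff-cons-*ᴾ : ∀ a p q k → coeff ((a ∷ p) *ᴾ q) k ≡ a * coeff q k + shift (coeff (p *ᴾ q)) k
coeff-cons-*ᴾ a p q k = trans (coeff-+ᴾ (scale a q) _ k) (cong₂ _+_ (coeff-scale a q k) (coeff-cons-zero k))
  where
  coeff-cons-zero : ∀ k → coeff (+ 0 ∷ (p *ᴾ q)) k ≡ shift (coeff (p *ᴾ q)) k
  coeff-cons-zero zero    = refl
  coeff-cons-zero (suc k) = refl

-- expanding (0 + 2x − x²) · q = 0 · q + x · (2 q + x · (−1 · q + x · 0))
coeff-2x-x² : ∀ q k → coeff (twoX-minus-X² *ᴾ q) k ≡ times2x-x² (coeff q) k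
coeff-2x-x² q zero
  rewrite coeff-cons-*ᴾ (+ 0) (+ 2 ∷ (+ 0 - + 1) ∷ []) q 0
  = arith (coeff q 0)
  where
  arith : ∀ a → + 0 * a + + 0 ≡ + 2 * + 0 - + 0
  arith = solve-∀
coeff-2x-x² q (suc zero)
  rewrite coeff-cons-*ᴾ (+ 0) (+ 2 ∷ (+ 0 - + 1) ∷ []) q 1
        | coeff-cons-*ᴾ (+ 2) ((+ 0 - + 1) ∷ []) q 0
  = arith (coeff q 1) (coeff q 0)
  where
  arith : ∀ a b → + 0 * a + (+ 2 * b + + 0) ≡ + 2 * b - + 0
  arith = solve-∀
coeff-2x-x² q (suc (suc k))
  rewrite coeff-cons-*ᴾ (+ 0) (+ 2 ∷ (+ 0 - + 1) ∷ []) q (suc (suc k))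
        | coeff-cons-*ᴾ (+ 2) ((+ 0 - + 1) ∷ []) q (suc k)
        | coeff-cons-*ᴾ (+ 0 - + 1) [] q k
        | shift-zero k
  = arith (coeff q (suc (suc k))) (coeff q (suc k)) (coeff q k)
  where
  arith : ∀ a b c → + 0 * a + (+ 2 * b + ((+ 0 - + 1) * c + + 0)) ≡ + 2 * b - c
  arith = solve-∀

times2x-x²-cong : ∀ {c d : ℕ → ℤ} → (∀ j → c j ≡ d j) → ∀ k → times2x-x² c k ≡ times2x-x² d k
times2x-x²-cong c≗d zero          = refl
times2x-x²-cong c≗d (suc zero)    = cong (λ s → + 2 * s - + 0) (c≗d 0)
times2x-x²-cong c≗d (suc (suc k)) = cong₂ (λ s t → + 2 * s - t) (c≗d (suc k)) (c≗d k)

times2x-x²-+ : ∀ (c d : ℕ → ℤ) k → times2x-x² (λ j → c j + d j) k ≡ times2x-x² c k + times2x-x² d k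
times2x-x²-+ c d zero          = refl
times2x-x²-+ c d (suc zero)    = arith (c 0) (d 0)
  where
  arith : ∀ a b → + 2 * (a + b) - + 0 ≡ (+ 2 * a - + 0) + (+ 2 * b - + 0)
  arith = solve-∀
times2x-x²-+ c d (suc (suc k)) = arith (c (suc k)) (d (suc k)) (c k) (d k)
  where
  arith : ∀ a b a′ b′ → + 2 * (a + b) - (a′ + b′) ≡ (+ 2 * a - a′) + (+ 2 * b - b′)
  arith = solve-∀

times2x-x²-scale : ∀ a (c : ℕ → ℤ) k → times2x-x² (λ j → a * c j) k ≡ a * times2x-x² c k
times2x-x²-scale a c zero          = arith a
  where
  arith : ∀ a → + 2 * + 0 - + 0 ≡ a * (+ 2 * + 0 - + 0)
  arith = solve-∀
times2x-x²-scale a c (suc zero)    = arith a (c 0)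
  where
  arith : ∀ a b → + 2 * (a * b) - + 0 ≡ a * (+ 2 * b - + 0)
  arith = solve-∀
times2x-x²-scale a c (suc (suc k)) = arith a (c (suc k)) (c k)
  where
  arith : ∀ a b b′ → + 2 * (a * b) - a * b′ ≡ a * (+ 2 * b - b′)
  arith = solve-∀

times2x-x²-sum : {A : Set} (xs : List A) (F : A → ℕ → ℤ) (k : ℕ) →
                 times2x-x² (λ j → sumOver xs (λ x → F x j)) k ≡ sumOver xs (λ x → times2x-x² (F x) k)
times2x-x²-sum []       F zero          = refl
times2x-x²-sum []       F (suc zero)    = refl
times2x-x²-sum []       F (suc (suc k)) = refl
times2x-x²-sum (x ∷ xs) F k =
  trans (times2x-x²-+ (F x) (λ j → sumOver xs (λ y → F y j)) k)
        (cong (λ s → times2x-x² (F x) k + s) (times2x-x²-sum xs F k))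

times2x-x²-xPow : ∀ m k → times2x-x² (xPow m) k ≡ + 2 * xPow (suc m) k - xPow (suc (suc m)) k
times2x-x²-xPow m zero    = refl
times2x-x²-xPow m (suc k) = cong (λ s → + 2 * xPow m k - s) (shift-xPow m k)

T-⇒ : ∀ {a b} → T (not a ∨ b) ⇔ (T a → T b)
T-⇒ {true}  = mk⇔ (λ tb _ → tb) (λ f → f tt)
T-⇒ {false} = mk⇔ (λ _ ()) (λ _ → tt)

T-not : ∀ {a} → T (not a) ⇔ (¬ T a)
T-not {true}  = mk⇔ (λ ()) (λ ¬t → ¬t tt)
T-not {false} = mk⇔ (λ _ ()) (λ _ → tt)

T-nor : ∀ {a b} → T (not (a ∨ b)) ⇔ (¬ T a × ¬ T b)
T-nor {true}  = mk⇔ (λ ()) (λ (¬t , _) → ¬t tt)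
T-nor {false} = mk⇔ (λ t → (λ ()) , to T-not t) (λ (_ , ¬t) → from T-not ¬t)

T-== : ∀ {n} {i j : Fin n} → T (i == j) ⇔ (i ≡ j)
T-== = mk⇔ toWitness fromWitness

==-refl : ∀ {n} (i : Fin n) → (i == i) ≡ true
==-refl i = to T-≡ (from (T-== {i = i}) refl)

==-false : ∀ {n} {i j : Fin n} → i ≢ j → (i == j) ≡ false
==-false i≢j = to T-not-≡ (fromWitnessFalse i≢j)

T-all-allFin : ∀ {n} (p : Fin n → Bool) → T (all p (allFin n)) ⇔ (∀ i → T (p i))
T-all-allFin p = mk⇔ (λ t i → All.lookup (all⁺ p (allFin _) t) (∈-allFin i))
                     (λ f → all⁻ p {allFin _} (All.tabulate (λ {i} _ → f i)))

T-any-allFin : ∀ {n} (p : Fin n → Bool) → T (any p (allFin n)) ⇔ (∃[ i ] T (p i))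
T-any-allFin p = mk⇔ (λ t → Any.satisfied (any⁻ p (allFin _) t))
                     (λ (i , t) → any⁺ {xs = allFin _} p (lose (∈-allFin i) t))

T-injective : ∀ {a b} → (T a → T b) → (T b → T a) → a ≡ b
T-injective {true}  {true}  _ _ = refl
T-injective {true}  {false} f _ = ⊥-elim (f tt)
T-injective {false} {true}  _ g = ⊥-elim (g tt)
T-injective {false} {false} _ _ = refl

infix 4 _∈_ _∉_
_∈_ : ∀ {n} → Fin n → Subset n → Set
i ∈ W = T (i ∈ˢ W)

_∉_ : ∀ {n} → Fin n → Subset n → Set
i ∉ W = ¬ (i ∈ W)

Adj : ∀ {n} → Graph n → Fin n → Fin n → Set
Adj G i j = T (adj G i j)

record IsIDS {n} (G : Graph n) (S W : Subset n) : Set where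
  field
    inside      : ∀ {i} → i ∈ W → i ∈ S
    independent : ∀ {i j} → i ∈ W → j ∈ W → ¬ Adj G i j
    dominating  : ∀ {x} → x ∈ S → x ∉ W → ∃[ w ] (w ∈ W × Adj G x w)
open IsIDS

isIDS⇔IsIDS : ∀ {n} (G : Graph n) (S W : Subset n) → T (isIDS G S W) ⇔ IsIDS G S W
isIDS⇔IsIDS {n} G S W = mk⇔ decode encode
  where
  insideB : Fin n → Bool
  insideB i = not (i ∈ˢ W) ∨ (i ∈ˢ S)
  independentB : Fin n → Fin n → Bool
  independentB i j = not ((i ∈ˢ W) ∧ (j ∈ˢ W)) ∨ not (adj G i j)
  dominatedB : Fin n → Bool
  dominatedB x = not ((x ∈ˢ S) ∧ not (x ∈ˢ W)) ∨ any (λ w → (w ∈ˢ W) ∧ adj G x w) (allFin n)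

  decode : T (isIDS G S W) → IsIDS G S W
  decode t = record
    { inside      = λ {i} → to T-⇒ (∀insideB i)
    ; independent = λ {i} {j} iW jW → to T-not
                      (to T-⇒ (to (T-all-allFin _) (∀independentB i) j)
                                          (from T-∧ (iW , jW)))
    ; dominating  = λ {x} xS x∉W →
        let (w , t′) = to (T-any-allFin _)
                         (to T-⇒ (∀dominatedB x)
                                             (from T-∧ (xS , from T-not x∉W)))
        in w , to T-∧ t′
    }
    where
    parts = to T-∧ t
    rest  = to T-∧ (proj₂ parts)
    ∀insideB     = to (T-all-allFin insideB) (proj₁ parts)
    ∀independentB = to (T-all-allFin _) (proj₁ rest)
    ∀dominatedB  = to (T-all-allFin dominatedB) (proj₂ rest)

  encode : IsIDS G S W → T (isIDS G S W)
  encode P = from T-∧ (∀insideB , from T-∧ (∀independentB , ∀dominatedB))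
    where
    ∀insideB = from (T-all-allFin insideB) (λ i → from T-⇒ (inside P))
    ∀independentB = from (T-all-allFin _) λ i → from (T-all-allFin (independentB i)) λ j →
      from T-⇒ λ t → let (iW , jW) = to T-∧ t in
        from T-not (independent P iW jW)
    ∀dominatedB = from (T-all-allFin dominatedB) λ x → from T-⇒ λ t →
      let (xS , x∉W) = to T-∧ t
          (w , wW , xw) = dominating P xS (to T-not x∉W)
      in from (T-any-allFin _) (w , from T-∧ (wW , xw))

isIDS-≡ : ∀ {n} {G H : Graph n} {S W S′ W′ : Subset n} →
          IsIDS G S W ⇔ IsIDS H S′ W′ → isIDS G S W ≡ isIDS H S′ W′
isIDS-≡ {G = G} {H} {S} {W} {S′} {W′} P⇔Q = T-injective
  (from (isIDS⇔IsIDS H S′ W′) ∘ to P⇔Q ∘ to (isIDS⇔IsIDS G S W))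
  (from (isIDS⇔IsIDS G S W) ∘ from P⇔Q ∘ to (isIDS⇔IsIDS H S′ W′))

isIDS-false : ∀ {n} {G : Graph n} {S W : Subset n} → ¬ IsIDS G S W → isIDS G S W ≡ false
isIDS-false {G = G} {S} {W} ¬P = to T-not-≡ (from T-not (¬P ∘ to (isIDS⇔IsIDS G S W)))

∈-full : ∀ {n} (i : Fin n) → i ∈ full n
∈-full i = subst T (sym (lookup∘tabulate (λ _ → true) i)) tt

∈-⁺-self : ∀ {n} (W : Subset n) z → z ∈ W ⁺ z
∈-⁺-self W z = subst T (sym (lookup∘update z W true)) tt

lookup-⁺-other : ∀ {n} (W : Subset n) {z i} → i ≢ z → lookup (W ⁺ z) i ≡ lookup W i
lookup-⁺-other W i≢z = lookup∘update′ i≢z W true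

∈-⁺ : ∀ {n} (W : Subset n) z {i} → i ∈ W → i ∈ W ⁺ z
∈-⁺ W z {i} iW with i ≟ z
... | yes refl = ∈-⁺-self W z
... | no i≢z   = subst T (sym (lookup-⁺-other W i≢z)) iW

∈-⁺-cases : ∀ {n} (W : Subset n) z {i} → i ∈ W ⁺ z → i ≡ z ⊎ i ∈ W
∈-⁺-cases W z {i} iW⁺ with i ≟ z
... | yes i≡z = inj₁ i≡z
... | no i≢z  = inj₂ (subst T (lookup-⁺-other W i≢z) iW⁺)

∉-⁺ : ∀ {n} (W : Subset n) {z i} → i ≢ z → i ∉ W → i ∉ W ⁺ z
∉-⁺ W i≢z i∉W = i∉W ∘ subst T (lookup-⁺-other W i≢z)

∣⁺∣ : ∀ {n} (W : Subset n) z → z ∉ W → ∣ W ⁺ z ∣ ≡ suc ∣ W ∣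
∣⁺∣ (true  ∷ W) zero    z∉W = ⊥-elim (z∉W tt)
∣⁺∣ (false ∷ W) zero    z∉W = refl
∣⁺∣ (true  ∷ W) (suc z) z∉W = cong suc (∣⁺∣ W z z∉W)
∣⁺∣ (false ∷ W) (suc z) z∉W = ∣⁺∣ W z z∉W

∈-outside⇔ : ∀ {n} (G : Graph n) z {i} → i ∈ minusClosedNbhd G z ⇔ (i ≢ z × ¬ Adj G z i)
∈-outside⇔ G z {i} rewrite lookup∘tabulate (λ w → not (closedNbhd G z w)) i =
  mk⇔ (λ t → let (¬i≡z , ¬zi) = to T-nor t in ¬i≡z ∘ from T-== , ¬zi)
      (λ (i≢z , ¬zi) → from T-nor (i≢z ∘ to T-== , ¬zi))

Adj-sym : ∀ {n} (G : Graph n) {i j} → Adj G i j → Adj G j i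
Adj-sym G {i} {j} = subst T (adj-sym G i j)

Adj⇒≢ : ∀ {n} (G : Graph n) {i j} → Adj G i j → i ≢ j
Adj⇒≢ G {i} ii refl = subst T (adj-irr G i) ii

∈∉⇒≢ : ∀ {n} (W : Subset n) {i j} → i ∈ W → j ∉ W → i ≢ j
∈∉⇒≢ W iW j∉W refl = j∉W iW

removeEdge-keeps : ∀ {n} (G : Graph n) u v {i j} → j ≢ u → j ≢ v →
                   adj (removeEdge G u v) i j ≡ adj G i j
removeEdge-keeps G u v {i} {j} j≢u j≢v
  rewrite ==-false j≢u | ==-false j≢v | ∧-zeroʳ (i == u) | ∧-zeroʳ (i == v) = ∧-identityʳ (adj G i j)

Adj-removeEdge⁺ : ∀ {n} (G : Graph n) u v {i j} → j ≢ u → j ≢ v → Adj G i j → Adj (removeEdge G u v) i j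
Adj-removeEdge⁺ G u v j≢u j≢v = subst T (sym (removeEdge-keeps G u v j≢u j≢v))

Adj-removeEdge⁻ : ∀ {n} (G : Graph n) u v {i j} → Adj (removeEdge G u v) i j → Adj G i j
Adj-removeEdge⁻ G u v = proj₁ ∘ to T-∧

¬Adj-removedEdge : ∀ {n} (G : Graph n) u v → ¬ Adj (removeEdge G u v) u v
¬Adj-removedEdge G u v uv′ =
  subst T (trans (sym isEdge) (to T-not-≡ (proj₂ (to T-∧ uv′)))) tt
  where
  isEdge : isEdgeUV u v u v ≡ true
  isEdge rewrite ==-refl u | ==-refl v = refl

¬IDS-outside : ∀ {n} (G : Graph n) (S W : Subset n) {z} → z ∈ W → z ∉ S → ¬ IsIDS G S W
¬IDS-outside G S W zW z∉S P = z∉S (inside P zW)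

¬IDS-adjacent : ∀ {n} (G : Graph n) (S W : Subset n) {i j} → i ∈ W → j ∈ W → Adj G i j → ¬ IsIDS G S W
¬IDS-adjacent G S W iW jW ij P = independent P iW jW ij

IDS-insert : ∀ {n} (G : Graph n) (W : Subset n) z → z ∉ W →
             IsIDS G (full n) (W ⁺ z) ⇔ IsIDS G (minusClosedNbhd G z) W
IDS-insert {n} G W z z∉W = mk⇔ forth back
  where
  outside = ∈-outside⇔ G z

  forth : IsIDS G (full n) (W ⁺ z) → IsIDS G (minusClosedNbhd G z) W
  forth P = record
    { inside      = λ iW → from outside
                      (∈∉⇒≢ W iW z∉W , λ zi → independent P (∈-⁺-self W z) (∈-⁺ W z iW) zi)
    ; independent = λ iW jW → independent P (∈-⁺ W z iW) (∈-⁺ W z jW)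
    ; dominating  = dominated
    }
    where
    dominated : ∀ {x} → x ∈ minusClosedNbhd G z → x ∉ W → ∃[ w ] (w ∈ W × Adj G x w)
    dominated {x} xS x∉W with to outside xS
    ... | x≢z , ¬zx with dominating P (∈-full x) (∉-⁺ W x≢z x∉W)
    ... | w , wW⁺ , xw with ∈-⁺-cases W z wW⁺
    ...   | inj₁ refl = ⊥-elim (¬zx (Adj-sym G xw))
    ...   | inj₂ wW   = w , wW , xw

  back : IsIDS G (minusClosedNbhd G z) W → IsIDS G (full n) (W ⁺ z)
  back Q = record { inside = λ {i} _ → ∈-full i ; independent = nonadjacent ; dominating = dominated }
    where
    ¬Adj-z : ∀ {j} → j ∈ W → ¬ Adj G z j
    ¬Adj-z jW = proj₂ (to outside (inside Q jW))

    nonadjacent : ∀ {i j} → i ∈ W ⁺ z → j ∈ W ⁺ z → ¬ Adj G i j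
    nonadjacent iW⁺ jW⁺ with ∈-⁺-cases W z iW⁺ | ∈-⁺-cases W z jW⁺
    ... | inj₁ refl | inj₁ refl = λ ii → Adj⇒≢ G ii refl
    ... | inj₁ refl | inj₂ jW   = ¬Adj-z jW
    ... | inj₂ iW   | inj₁ refl = ¬Adj-z iW ∘ Adj-sym G
    ... | inj₂ iW   | inj₂ jW   = independent Q iW jW

    -- a neighbour x of z is dominated by z; any other x ∉ W ∪ {z} is dominated by W
    dominated : ∀ {x} → x ∈ full n → x ∉ W ⁺ z → ∃[ w ] (w ∈ W ⁺ z × Adj G x w)
    dominated {x} _ x∉W⁺ with ≢-sym (∈∉⇒≢ (W ⁺ z) (∈-⁺-self W z) x∉W⁺) | T? (adj G z x)
    ... | x≢z | yes zx = z , ∈-⁺-self W z , Adj-sym G zx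
    ... | x≢z | no ¬zx with dominating Q (from outside (x≢z , ¬zx)) (x∉W⁺ ∘ ∈-⁺ W z)
    ...   | w , wW , xw = w , ∈-⁺ W z wW , xw

IDS-removeEdge : ∀ {n} (G : Graph n) (S W : Subset n) u v → u ∉ W → v ∉ W →
                 IsIDS G S W ⇔ IsIDS (removeEdge G u v) S W
IDS-removeEdge G S W u v u∉W v∉W = mk⇔
  (λ P → record
    { inside      = inside P
    ; independent = λ iW jW → independent P iW jW ∘ Adj-removeEdge⁻ G u v
    ; dominating  = λ xS x∉W → let (w , wW , xw) = dominating P xS x∉W in w , wW , keep wW xw })
  (λ Q → record
    { inside      = inside Q
    ; independent = λ iW jW → independent Q iW jW ∘ keep jW
    ; dominating  = λ xS x∉W → let (w , wW , xw) = dominating Q xS x∉W in w , wW , Adj-removeEdge⁻ G u v xw })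
  where
  keep : ∀ {x w} → w ∈ W → Adj G x w → Adj (removeEdge G u v) x w
  keep wW = Adj-removeEdge⁺ G u v (∈∉⇒≢ W wW u∉W) (∈∉⇒≢ W wW v∉W)

¬IDS-shadowed : ∀ {n} (H : Graph n) (S W : Subset n) {y z} → z ∈ S → z ≢ y → z ∉ W → ¬ Adj H z y →
                (∀ {w} → w ∈ W → Adj H z w → Adj H y w) → ¬ IsIDS H S (W ⁺ y)
¬IDS-shadowed H S W {y} {z} zS z≢y z∉W ¬zy shadow P with dominating P zS (∉-⁺ W z≢y z∉W)
... | w , wW⁺ , zw with ∈-⁺-cases W y wW⁺
...   | inj₁ refl = ¬zy zw
...   | inj₂ wW   = independent P (∈-⁺-self W y) (∈-⁺ W y wW) (shadow wW zw)

module Twins {n} (G : Graph n) {u v : Fin n} (uv : Adj G u v)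
             (twins : ∀ w → closedNbhd G u w ≡ closedNbhd G v w) where

  G-e : Graph n
  G-e = removeEdge G u v

  S : Subset n
  S = minusClosedNbhd G u

  u≢v : u ≢ v
  u≢v = Adj⇒≢ G uv

  twin-adj : ∀ {w} → w ≢ u → w ≢ v → adj G u w ≡ adj G v w
  twin-adj {w} w≢u w≢v with twins w
  ... | N[u]w≡N[v]w rewrite ==-false w≢u | ==-false w≢v = N[u]w≡N[v]w

  twin-adj-G-e : ∀ {w} → w ≢ u → w ≢ v → adj G-e u w ≡ adj G-e v w
  twin-adj-G-e {w} w≢u w≢v = begin
    adj G-e u w ≡⟨ removeEdge-keeps G u v w≢u w≢v ⟩
    adj G u w   ≡⟨ twin-adj w≢u w≢v ⟩
    adj G v w   ≡⟨ sym (removeEdge-keeps G u v w≢u w≢v) ⟩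
    adj G-e v w ∎

  twin-outside : minusClosedNbhd G v ≡ S
  twin-outside = tabulate-cong (λ w → cong not (sym (twins w)))

  u∉S : u ∉ S
  u∉S uS = proj₁ (to (∈-outside⇔ G u) uS) refl

  v∉S : v ∉ S
  v∉S vS = proj₂ (to (∈-outside⇔ G u) vS) uv

  ¬Adj-u-S : ∀ {j} → j ∈ S → ¬ Adj G u j
  ¬Adj-u-S jS = proj₂ (to (∈-outside⇔ G u) jS)

  ¬Adj-v-S : ∀ {j} → j ∈ S → ¬ Adj G v j
  ¬Adj-v-S {j} jS = proj₂ (to (∈-outside⇔ G v) (subst (j ∈_) (sym twin-outside) jS))

  module _ (W : Subset n) (u∉W : u ∉ W) (v∉W : v ∉ W) where

    -- in G − e, W ∪ {u} leaves v undominated and W ∪ {v} leaves u undominated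
    ¬IDS-G-e-⁺u : ¬ IsIDS G-e (full n) (W ⁺ u)
    ¬IDS-G-e-⁺u = ¬IDS-shadowed G-e (full n) W (∈-full v) (≢-sym u≢v) v∉W
      (¬Adj-removedEdge G u v ∘ Adj-sym G-e)
      (λ wW → subst T (sym (twin-adj-G-e (∈∉⇒≢ W wW u∉W) (∈∉⇒≢ W wW v∉W))))

    ¬IDS-G-e-⁺v : ¬ IsIDS G-e (full n) (W ⁺ v)
    ¬IDS-G-e-⁺v = ¬IDS-shadowed G-e (full n) W (∈-full u) u≢v u∉W
      (¬Adj-removedEdge G u v)
      (λ wW → subst T (twin-adj-G-e (∈∉⇒≢ W wW u∉W) (∈∉⇒≢ W wW v∉W)))

    private
      X : Subset n
      X = W ⁺ v ⁺ u

      X-cases : ∀ {i} → i ∈ X → (i ≡ u ⊎ i ≡ v) ⊎ i ∈ W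
      X-cases iX with ∈-⁺-cases (W ⁺ v) u iX
      ... | inj₁ i≡u = inj₁ (inj₁ i≡u)
      ... | inj₂ iW⁺ with ∈-⁺-cases W v iW⁺
      ...   | inj₁ i≡v = inj₁ (inj₂ i≡v)
      ...   | inj₂ iW  = inj₂ iW

      u∈X : u ∈ X
      u∈X = ∈-⁺-self (W ⁺ v) u

      v∈X : v ∈ X
      v∈X = ∈-⁺ (W ⁺ v) u (∈-⁺-self W v)

      W⊆X : ∀ {i} → i ∈ W → i ∈ X
      W⊆X iW = ∈-⁺ (W ⁺ v) u (∈-⁺ W v iW)

      keep : ∀ {x w} → w ∈ W → Adj G x w → Adj G-e x w
      keep wW = Adj-removeEdge⁺ G u v (∈∉⇒≢ W wW u∉W) (∈∉⇒≢ W wW v∉W)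

      ¬Adj-ends : ∀ {i j} → i ≡ u ⊎ i ≡ v → j ≡ u ⊎ j ≡ v → ¬ Adj G-e i j
      ¬Adj-ends (inj₁ refl) (inj₁ refl) ii = Adj⇒≢ G-e ii refl
      ¬Adj-ends (inj₁ refl) (inj₂ refl)    = ¬Adj-removedEdge G u v
      ¬Adj-ends (inj₂ refl) (inj₁ refl)    = ¬Adj-removedEdge G u v ∘ Adj-sym G-e
      ¬Adj-ends (inj₂ refl) (inj₂ refl) ii = Adj⇒≢ G-e ii refl

      ¬Adj-end-S : ∀ {i j} → i ≡ u ⊎ i ≡ v → j ∈ S → ¬ Adj G-e i j
      ¬Adj-end-S (inj₁ refl) jS = ¬Adj-u-S jS ∘ Adj-removeEdge⁻ G u v
      ¬Adj-end-S (inj₂ refl) jS = ¬Adj-v-S jS ∘ Adj-removeEdge⁻ G u v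

    IDS-G-e-⁺uv : IsIDS G-e (full n) X ⇔ IsIDS G S W
    IDS-G-e-⁺uv = mk⇔ forth back
      where
      forth : IsIDS G-e (full n) X → IsIDS G S W
      forth P = record
        { inside      = λ iW → from (∈-outside⇔ G u)
                          (∈∉⇒≢ W iW u∉W , independent P u∈X (W⊆X iW) ∘ keep iW)
        ; independent = λ iW jW → independent P (W⊆X iW) (W⊆X jW) ∘ keep jW
        ; dominating  = dominated
        }
        where
        -- x ∈ S is dominated in G − e by some w ∈ X, which can be neither u nor v
        dominated : ∀ {x} → x ∈ S → x ∉ W → ∃[ w ] (w ∈ W × Adj G x w)
        dominated {x} xS x∉W with ∈∉⇒≢ S xS u∉S | ∈∉⇒≢ S xS v∉S
        ... | x≢u | x≢v with dominating P (∈-full x) (∉-⁺ (W ⁺ v) x≢u (∉-⁺ W x≢v x∉W))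
        ... | w , wX , xw′ with X-cases wX | Adj-removeEdge⁻ G u v xw′
        ...   | inj₁ (inj₁ refl) | xu = ⊥-elim (¬Adj-u-S xS (Adj-sym G xu))
        ...   | inj₁ (inj₂ refl) | xv = ⊥-elim (¬Adj-v-S xS (Adj-sym G xv))
        ...   | inj₂ wW          | xw = w , wW , xw

      back : IsIDS G S W → IsIDS G-e (full n) X
      back Q = record { inside = λ {i} _ → ∈-full i ; independent = nonadjacent ; dominating = dominated }
        where
        nonadjacent : ∀ {i j} → i ∈ X → j ∈ X → ¬ Adj G-e i j
        nonadjacent iX jX with X-cases iX | X-cases jX
        ... | inj₁ ei | inj₁ ej = ¬Adj-ends ei ej
        ... | inj₁ ei | inj₂ jW = ¬Adj-end-S ei (inside Q jW)
        ... | inj₂ iW | inj₁ ej = ¬Adj-end-S ej (inside Q iW) ∘ Adj-sym G-e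
        ... | inj₂ iW | inj₂ jW = independent Q iW jW ∘ Adj-removeEdge⁻ G u v

        -- a neighbour x of u is dominated by u; any other x ∉ X lies in S and is dominated by W
        dominated : ∀ {x} → x ∈ full n → x ∉ X → ∃[ w ] (w ∈ X × Adj G-e x w)
        dominated {x} _ x∉X with ≢-sym (∈∉⇒≢ X u∈X x∉X) | ≢-sym (∈∉⇒≢ X v∈X x∉X) | T? (adj G u x)
        ... | x≢u | x≢v | yes ux = u , u∈X , Adj-sym G-e (Adj-removeEdge⁺ G u v x≢u x≢v ux)
        ... | x≢u | x≢v | no ¬ux with dominating Q (from (∈-outside⇔ G u) (x≢u , ¬ux)) (x∉X ∘ W⊆X)
        ...   | w , wW , xw = w , W⊆X wW , keep wW xw

  lhsTerm : ℕ → Subset n → ℤ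
  lhsTerm k W = ι (isIDS G (full n) W) * xPow ∣ W ∣ k

  rhsTerm : ℕ → Subset n → ℤ
  rhsTerm k W = ι (isIDS G-e (full n) W) * xPow ∣ W ∣ k
              + ι (isIDS G S W) * (+ 2 * xPow (suc ∣ W ∣) k - xPow (suc (suc ∣ W ∣)) k)

  coeff-rhs : ∀ k → coeff (ID G-e +ᴾ (twoX-minus-X² *ᴾ IDpoly G S)) k ≡ ΣSubsets n (rhsTerm k)
  coeff-rhs k = begin
    coeff (ID G-e +ᴾ (twoX-minus-X² *ᴾ IDpoly G S)) k
      ≡⟨ coeff-+ᴾ (ID G-e) _ k ⟩
    coeff (ID G-e) k + coeff (twoX-minus-X² *ᴾ IDpoly G S) k
      ≡⟨ cong₂ _+_ (coeff-IDpoly G-e (full n) k) (coeff-2x-x² (IDpoly G S) k) ⟩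
    ΣSubsets n idsG-e + times2x-x² (coeff (IDpoly G S)) k
      ≡⟨ cong (λ s → ΣSubsets n idsG-e + s) (times2x-x²-cong (coeff-IDpoly G S) k) ⟩
    ΣSubsets n idsG-e + times2x-x² (λ j → ΣSubsets n (λ W → ι (isIDS G S W) * xPow ∣ W ∣ j)) k
      ≡⟨ cong (λ s → ΣSubsets n idsG-e + s) (times2x-x²-sum (allSubsets n) _ k) ⟩
    ΣSubsets n idsG-e + ΣSubsets n (λ W → times2x-x² (λ j → ι (isIDS G S W) * xPow ∣ W ∣ j) k)
      ≡⟨ cong (λ s → ΣSubsets n idsG-e + s) (sumOver-cong (allSubsets n) times-monomial) ⟩
    ΣSubsets n idsG-e + ΣSubsets n (λ W → ι (isIDS G S W) * (+ 2 * xPow (suc ∣ W ∣) k - xPow (suc (suc ∣ W ∣)) k))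
      ≡⟨ sym (sumOver-+ (allSubsets n) _ _) ⟩
    ΣSubsets n (rhsTerm k) ∎
    where
    idsG-e : Subset n → ℤ
    idsG-e W = ι (isIDS G-e (full n) W) * xPow ∣ W ∣ k

    times-monomial : ∀ W → times2x-x² (λ j → ι (isIDS G S W) * xPow ∣ W ∣ j) k
                         ≡ ι (isIDS G S W) * (+ 2 * xPow (suc ∣ W ∣) k - xPow (suc (suc ∣ W ∣)) k)
    times-monomial W = trans (times2x-x²-scale (ι (isIDS G S W)) (xPow ∣ W ∣) k) (cong (ι (isIDS G S W) *_) (times2x-x²-xPow ∣ W ∣ k))

  -- For W avoiding u and v, the subsets W, W ∪ {u}, W ∪ {v}, W ∪ {u , v} contribute equally to both sides:
  -- a x^m + 2b x^(m+1)  versus  a x^m + b (2x − x²) x^m + b x^(m+2),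
  -- where a = [W is an IDS of G − e] and b = [W is an IDS of G − N[u]].
  quad-agree : ∀ k W → u ∉ W → v ∉ W → quad u v (lhsTerm k) W ≡ quad u v (rhsTerm k) W
  quad-agree k W u∉W v∉W
    -- ID(G): W, W ∪ {u}, W ∪ {v}, W ∪ {u , v}
    rewrite isIDS-≡ (IDS-removeEdge G (full n) W u v u∉W v∉W)
          | isIDS-≡ (IDS-insert G W u u∉W)
          | isIDS-≡ (IDS-insert G W v v∉W) | twin-outside
          | isIDS-false (¬IDS-adjacent G (full n) (W ⁺ v ⁺ u) (∈-⁺-self (W ⁺ v) u) (∈-⁺ (W ⁺ v) u (∈-⁺-self W v)) uv)
          -- ID(G − e): W ∪ {u}, W ∪ {v}, W ∪ {u , v}
          | isIDS-false (¬IDS-G-e-⁺u W u∉W v∉W)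
          | isIDS-false (¬IDS-G-e-⁺v W u∉W v∉W)
          | isIDS-≡ (IDS-G-e-⁺uv W u∉W v∉W)
          -- ID(G − N[u]): W ∪ {u}, W ∪ {v}, W ∪ {u , v}
          | isIDS-false (¬IDS-outside G S (W ⁺ u) (∈-⁺-self W u) u∉S)
          | isIDS-false (¬IDS-outside G S (W ⁺ v) (∈-⁺-self W v) v∉S)
          | isIDS-false (¬IDS-outside G S (W ⁺ v ⁺ u) (∈-⁺-self (W ⁺ v) u) u∉S)
          | ∣⁺∣ (W ⁺ v) u (∉-⁺ W u≢v u∉W) | ∣⁺∣ W u u∉W | ∣⁺∣ W v v∉W
          = identity (ι (isIDS G-e (full n) W)) (ι (isIDS G S W))
                     (xPow ∣ W ∣ k) (xPow (suc ∣ W ∣) k) (xPow (suc (suc ∣ W ∣)) k)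
                     (xPow (suc (suc (suc ∣ W ∣))) k) (xPow (suc (suc (suc (suc ∣ W ∣)))) k)
    where
    identity : ∀ a b p₀ p₁ p₂ p₃ p₄ →
      a * p₀ + b * p₁ + b * p₁ + + 0 * p₂
      ≡ (a * p₀ + b * (+ 2 * p₁ - p₂)) + (+ 0 * p₁ + + 0 * (+ 2 * p₂ - p₃))
        + (+ 0 * p₁ + + 0 * (+ 2 * p₂ - p₃)) + (b * p₂ + + 0 * (+ 2 * p₃ - p₄))
    identity = solve-∀

ι-avoids-cong : ∀ {n} (u v : Fin n) W {x y : ℤ} → (u ∉ W → v ∉ W → x ≡ y) →
                ι (avoids u v W) * x ≡ ι (avoids u v W) * y
ι-avoids-cong u v W {x} {y} x≡y with lookup W u | lookup W v
... | false | false = cong (+ 1 *_) (x≡y (λ ()) (λ ()))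
... | false | true  = refl
... | true  | _     = refl

mainTheorem16 : ∀ {n : ℕ} (G : Graph n) (u v : Fin n)
                → adj G u v ≡ true
                → (∀ w → closedNbhd G u w ≡ closedNbhd G v w)
                → ID G ≈ᴾ (ID (removeEdge G u v) +ᴾ (twoX-minus-X² *ᴾ IDpoly G (minusClosedNbhd G u)))
mainTheorem16 {n} G u v uv twins k = begin
  coeff (ID G) k                                                ≡⟨ coeff-IDpoly G (full n) k ⟩
  ΣSubsets n (lhsTerm k)                                        ≡⟨ ΣSubsets-pair u≢v (lhsTerm k) ⟩
  ΣSubsets n (λ W → ι (avoids u v W) * quad u v (lhsTerm k) W)  ≡⟨ sumOver-cong (allSubsets n) agree ⟩
  ΣSubsets n (λ W → ι (avoids u v W) * quad u v (rhsTerm k) W)  ≡⟨ sym (ΣSubsets-pair u≢v (rhsTerm k)) ⟩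
  ΣSubsets n (rhsTerm k)                                        ≡⟨ sym (coeff-rhs k) ⟩
  coeff (ID (removeEdge G u v) +ᴾ (twoX-minus-X² *ᴾ IDpoly G (minusClosedNbhd G u))) k ∎
  where
  open Twins G (subst T (sym uv) tt) twins
  agree : ∀ W → ι (avoids u v W) * quad u v (lhsTerm k) W ≡ ι (avoids u v W) * quad u v (rhsTerm k) W
  agree W = ι-avoids-cong u v W (quad-agree k W)
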